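{- Let $G$ be a connected graph with root $r$ such that $G$ satisfies the rooted triangle condition, and let $u,v\in V(G)$. If the daisy graph $G_r(\{u,v\})$ is isometric in $G$, then there exists a pseudo-median in $G$ of size $0$ or $1$ of the triple $(u,v,r)$.
   Context: Distances are shortest-path distances; $I_G(a,b)=\{x: d(a,x)+d(x,b)=d(a,b)\}$. For $X\subseteq V(G)$, the daisy graph $G_r(X)$ is the subgraph of $G$ induced by $\bigcup_{v\in X} I_G(r,v)$; it is isometric if $d_{G_r(X)}(a,b)=d_G(a,b)$ for all its vertices $a,b$. $G$ satisfies the rooted triangle condition if for any two adjacent vertices $v,w$ with $d(r,v)=d(r,w)\ge 2$ there is a vertex $x$ adjacent to both with $d(x,r)=d(r,v)-1$. A triple $(x,y,z)$ is a pseudo-median of $(u,v,w)$ if: (1) some shortest $u,v$-path contains $x,y$, some shortest $v,w$-path contains $y,z$, some shortest $u,w$-path contains $x,z$; (2) $d(x,y)=d(y,z)=d(x,z)$; (3) $d(x,y)$ is minimal subject to (1),(2). Its size is $d(x,y)$. -}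

module Defs where

open import Level using (0ℓ)
open import Data.Nat using (ℕ; zero; suc; _+_; _≤_; _∸_)
open import Data.Fin using (Fin)
open import Data.Product using (Σ; ∃; ∃-syntax; _×_; _,_)
open import Data.Sum using (_⊎_)
open import Data.Unit using (⊤)
open import Relation.Nullary using (¬_; Dec)
open import Relation.Binary.PropositionalEquality using (_≡_)

record Graph : Set₁ where
  field
    n     : ℕ
    Adj   : Fin n → Fin n → Set
    adj?  : ∀ a b → Dec (Adj a b)
    sym   : ∀ {a b} → Adj a b → Adj b a
    irrefl : ∀ {a} → ¬ Adj a a

module _ (G : Graph) where
  open Graph G

  V : Set
  V = Fin n

  data WalkIn (P : V → Set) : V → V → ℕ → Set where
    [_]  : ∀ {a} → P a → WalkIn P a a 0
    _∷⟨_⟩_ : ∀ {a b c k} → P a → Adj a b → WalkIn P b c k → WalkIn P a c (suc k)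

  Walk : V → V → ℕ → Set
  Walk = WalkIn (λ _ → ⊤)

  data _∈W_ {P : V → Set} (x : V) : ∀ {a b k} → WalkIn P a b k → Set where
    here-nil  : (p : P x) → x ∈W [ p ]
    here-cons : ∀ {b c k} (p : P x) (e : Adj x b) (w : WalkIn P b c k) → x ∈W (p ∷⟨ e ⟩ w)
    there     : ∀ {a b c k} (p : P a) (e : Adj a b) {w : WalkIn P b c k} → x ∈W w → x ∈W (p ∷⟨ e ⟩ w)

  DistIn : (V → Set) → V → V → ℕ → Set
  DistIn P a b k = WalkIn P a b k × (∀ m → WalkIn P a b m → k ≤ m)

  Dist : V → V → ℕ → Set
  Dist = DistIn (λ _ → ⊤)

  Connected : Set
  Connected = ∀ a b → ∃[ k ] Walk a b k

  Interval : V → V → V → Set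
  Interval a b x = ∃[ k₁ ] ∃[ k₂ ] (Dist a x k₁ × Dist x b k₂ × Dist a b (k₁ + k₂))

  RootedTriangle : V → Set
  RootedTriangle r = ∀ v w k → Adj v w → Dist r v k → Dist r w k → 2 ≤ k →
    ∃[ x ] (Adj x v × Adj x w × Dist x r (k ∸ 1))

  -- Vertex set of the daisy graph G_r(X) for X = {u, v}
  InDaisy : V → V → V → V → Set
  InDaisy r u v x = Interval r u x ⊎ Interval r v x

  IsometricDaisy : V → V → V → Set
  IsometricDaisy r u v = ∀ a b → InDaisy r u v a → InDaisy r u v b →
    ∀ k → Dist a b k → DistIn (InDaisy r u v) a b k

  OnGeodesic : V → V → V → V → Set
  OnGeodesic a b x y = ∃[ k ] Σ (Walk a b k) λ w → Dist a b k × x ∈W w × y ∈W w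

  PMCandidate : V → V → V → V → V → V → ℕ → Set
  PMCandidate u v w x y z k =
    OnGeodesic u v x y × OnGeodesic v w y z × OnGeodesic u w x z ×
    Dist x y k × Dist y z k × Dist x z k

  PseudoMedian : V → V → V → V → V → V → ℕ → Set
  PseudoMedian u v w x y z k = PMCandidate u v w x y z k ×
    (∀ x' y' z' k' → PMCandidate u v w x' y' z' k' → k ≤ k')

-- Isometry gives a shortest u,v-path running inside I(r,u) ∪ I(r,v).
-- It starts in I(r,u); either it never leaves I(r,u) (then v ∈ I(r,u) and v
-- is a median of u, v, r), or it has an edge x–y with x ∈ I(r,u) and
-- y ∈ I(r,v).  Comparing the levels d(r,x) and d(r,y): if they differ, the
-- endpoint closer to r is a median; if they are equal, the rooted triangle
-- condition supplies a common neighbour z one level closer to r, and (x,y,z)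
-- satisfies conditions (1),(2) with size 1.  A size-0 candidate is exactly a
-- median, so deciding whether a median exists settles minimality.
module Submission where

open import Defs
open import Data.Nat using (ℕ; zero; suc; _+_; _≤_; _<_; _≟_; z≤n; s≤s)
open import Data.Nat.Properties
open import Data.Nat.Induction using (<-rec)
open import Data.Fin using () renaming (_≟_ to _≟ᶠ_)
open import Data.Fin.Properties using (any?)
open import Data.Product using (Σ; ∃; ∃-syntax; _×_; _,_; proj₁; proj₂)
open import Data.Sum using (_⊎_; inj₁; inj₂)
open import Data.Unit using (tt)
open import Data.Empty using (⊥-elim)
open import Relation.Binary using (tri<; tri≈; tri>)
open import Relation.Nullary using (¬_; Dec; yes; no)
open import Relation.Nullary.Decidable using (_×-dec_)
open import Relation.Unary using (Decidable)
open import Relation.Binary.PropositionalEquality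

LeastWitness : (ℕ → Set) → Set
LeastWitness P = Σ ℕ λ m → P m × (∀ m′ → P m′ → m ≤ m′)

-- A decidable predicate on ℕ with some witness has a least one; this is
-- what turns "G is connected" into a distance function.
least-witness : {P : ℕ → Set} → Decidable P → ∀ K → P K → LeastWitness P
least-witness {P} P? = <-rec (λ K → P K → LeastWitness P) step
  where
  step : ∀ K → (∀ {n} → n < K → P n → LeastWitness P) → P K → LeastWitness P
  step K smaller pK with anyUpTo? P? K
  ... | yes (n , n<K , pn) = smaller n<K pn
  ... | no none = K , pK , λ m pm → ≮⇒≥ (λ m<K → none (m , m<K , pm))

module Walks (G : Graph) where
  open Graph G using (Adj; adj?) renaming (sym to adj-sym)

  private variable
    a b c x : V G
    i j k : ℕ
    P : V G → Set

  _++_ : Walk G a b i → Walk G b c j → Walk G a c (i + j)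
  [ _ ] ++ w′ = w′
  (p ∷⟨ e ⟩ w) ++ w′ = p ∷⟨ e ⟩ (w ++ w′)

  start-∈ : (w : Walk G a b k) → _∈W_ G a w
  start-∈ [ p ] = here-nil p
  start-∈ (p ∷⟨ e ⟩ w) = here-cons p e w

  ∈-++ʳ : (w : Walk G a b i) {w′ : Walk G b c j} → _∈W_ G x w′ → _∈W_ G x (w ++ w′)
  ∈-++ʳ [ _ ] x∈w′ = x∈w′
  ∈-++ʳ (p ∷⟨ e ⟩ w) x∈w′ = there p e (∈-++ʳ w x∈w′)

  snoc : Walk G a b k → Adj b c → Walk G a c (suc k)
  snoc [ _ ] e = tt ∷⟨ e ⟩ [ tt ]
  snoc (p ∷⟨ e′ ⟩ w) e = p ∷⟨ e′ ⟩ snoc w e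

  reverse : Walk G a b k → Walk G b a k
  reverse [ p ] = [ p ]
  reverse (p ∷⟨ e ⟩ w) = snoc (reverse w) (adj-sym e)

  split-at : (w : Walk G a b k) → _∈W_ G x w →
             Σ ℕ λ i → Σ ℕ λ j → Walk G a x i × Walk G x b j × i + j ≡ k
  split-at [ _ ] (here-nil _) = 0 , 0 , [ tt ] , [ tt ] , refl
  split-at (p ∷⟨ e ⟩ w) (here-cons _ _ _) = 0 , _ , [ tt ] , (p ∷⟨ e ⟩ w) , refl
  split-at (p ∷⟨ e ⟩ w) (there _ _ x∈w) with split-at w x∈w
  ... | i , j , w₁ , w₂ , i+j≡k = suc i , j , (p ∷⟨ e ⟩ w₁) , w₂ , cong suc i+j≡k

  empty-walk : Walk G a b 0 → a ≡ b
  empty-walk [ _ ] = refl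

  walk? : ∀ k a b → Dec (Walk G a b k)
  walk? zero a b with a ≟ᶠ b
  ... | yes refl = yes [ tt ]
  ... | no a≢b = no λ w → a≢b (empty-walk w)
  walk? (suc k) a b with any? (λ c → adj? a c ×-dec walk? k c b)
  ... | yes (c , e , w) = yes (tt ∷⟨ e ⟩ w)
  ... | no none = no λ { (_ ∷⟨ e ⟩ w) → none (_ , e , w) }

  forget : WalkIn G P a b k → Walk G a b k
  forget [ _ ] = [ tt ]
  forget (_ ∷⟨ e ⟩ w) = tt ∷⟨ e ⟩ forget w

  head-in : WalkIn G P a b k → P a
  head-in [ p ] = p
  head-in (p ∷⟨ _ ⟩ _) = p

  Crossing : (A B : V G → Set) → V G → V G → ℕ → Set
  Crossing A B a b k = Σ (V G) λ x → Σ (V G) λ y → Adj x y × A x × B y ×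
    Σ ℕ λ i → Σ ℕ λ j → Walk G a x i × Walk G y b j × i + suc j ≡ k

  crossing : {A B : V G → Set} → WalkIn G (λ z → A z ⊎ B z) a b k → A a →
             A b ⊎ Crossing A B a b k
  crossing [ _ ] a∈A = inj₁ a∈A
  crossing (_ ∷⟨ e ⟩ w) a∈A with head-in w
  ... | inj₂ next∈B = inj₂ (_ , _ , e , a∈A , next∈B , 0 , _ , [ tt ] , forget w , refl)
  ... | inj₁ next∈A with crossing w next∈A
  ...   | inj₁ b∈A = inj₁ b∈A
  ...   | inj₂ (x , y , exy , x∈A , y∈B , i , j , w₁ , w₂ , len) =
    inj₂ (x , y , exy , x∈A , y∈B , suc i , j , tt ∷⟨ e ⟩ w₁ , w₂ , cong suc len)

module Metric (G : Graph) (connected : Connected G) where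
  open Graph G using (Adj; irrefl) renaming (sym to adj-sym)
  open Walks G

  private variable
    a b m x y z : V G
    k : ℕ

  shortest : ∀ a b → LeastWitness (λ k → Walk G a b k)
  shortest a b = least-witness (λ k → walk? k a b) _ (proj₂ (connected a b))

  d : V G → V G → ℕ
  d a b = proj₁ (shortest a b)

  geodesic : ∀ a b → Walk G a b (d a b)
  geodesic a b = proj₁ (proj₂ (shortest a b))

  d-minimal : Walk G a b k → d a b ≤ k
  d-minimal {a} {b} w = proj₂ (proj₂ (shortest a b)) _ w

  dist-d : ∀ a b → Dist G a b (d a b)
  dist-d a b = geodesic a b , λ _ → d-minimal

  dist-unique : Dist G a b k → k ≡ d a b
  dist-unique (w , minimal) = ≤-antisym (minimal _ (geodesic _ _)) (d-minimal w)

  dist-of : d a b ≡ k → Dist G a b k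
  dist-of {a} {b} eq = subst (Dist G a b) eq (dist-d a b)

  d-sym : ∀ a b → d a b ≡ d b a
  d-sym a b = ≤-antisym (d-minimal (reverse (geodesic b a))) (d-minimal (reverse (geodesic a b)))

  d-triangle : ∀ a b c → d a c ≤ d a b + d b c
  d-triangle a b c = d-minimal (geodesic a b ++ geodesic b c)

  d-self : ∀ a → d a a ≡ 0
  d-self a = n≤0⇒n≡0 (d-minimal {a} {a} [ tt ])

  d≡0⇒≡ : d a b ≡ 0 → a ≡ b
  d≡0⇒≡ {a} {b} eq = empty-walk (subst (Walk G a b) eq (geodesic a b))

  adjacent⇒d≡1 : Adj a b → d a b ≡ 1
  adjacent⇒d≡1 {a} {b} e with d a b in eq | d-minimal (tt ∷⟨ e ⟩ [ tt ])
  ... | zero | _ = ⊥-elim (irrefl (subst (Adj a) (sym (d≡0⇒≡ eq)) e))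
  ... | suc zero | _ = refl
  ... | suc (suc _) | s≤s ()

  Between : V G → V G → V G → Set
  Between a b m = d a m + d m b ≡ d a b

  between-≤ : d a m + d m b ≤ d a b → Between a b m
  between-≤ {a} {m} {b} h = ≤-antisym h (d-triangle a m b)

  between-sym : Between a b m → Between b a m
  between-sym {a} {b} {m} between = begin
    d b m + d m a ≡⟨ cong₂ _+_ (d-sym b m) (d-sym m a) ⟩
    d m b + d a m ≡⟨ +-comm (d m b) (d a m) ⟩
    d a m + d m b ≡⟨ between ⟩
    d a b         ≡⟨ d-sym a b ⟩
    d b a         ∎
    where open ≡-Reasoning

  between-start : ∀ a b → Between a b a
  between-start a b = cong (_+ d a b) (d-self a)

  between-end : ∀ a b → Between a b b
  between-end a b = trans (cong (d a b +_) (d-self b)) (+-identityʳ _)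

  interval⇒between : Interval G a b m → Between a b m
  interval⇒between (_ , _ , dam , dmb , dab) =
    trans (cong₂ _+_ (sym (dist-unique dam)) (sym (dist-unique dmb))) (dist-unique dab)

  between⇒interval : Between a b m → Interval G a b m
  between⇒interval {a} {b} {m} between =
    d a m , d m b , dist-d a m , dist-d m b , dist-of (sym between)

  on-geodesic : d a x + (d x y + d y b) ≤ d a b → OnGeodesic G a b x y
  on-geodesic {a} {x} {y} {b} short = _ , w , (w , λ _ w′ → ≤-trans short (d-minimal w′)) ,
      ∈-++ʳ (geodesic a x) (start-∈ _) ,
      ∈-++ʳ (geodesic a x) (∈-++ʳ (geodesic x y) (start-∈ (geodesic y b)))
    where w = geodesic a x ++ (geodesic x y ++ geodesic y b)

  on-geodesic-via : Between a b x → Between x b y → OnGeodesic G a b x y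
  on-geodesic-via {a} {b} {x} {y} abx xby = on-geodesic (≤-reflexive (begin
    d a x + (d x y + d y b) ≡⟨ cong (d a x +_) xby ⟩
    d a x + d x b         ≡⟨ abx ⟩
    d a b                 ∎))
    where open ≡-Reasoning

  between⇒on-geodesic : Between a b m → OnGeodesic G a b m m
  between⇒on-geodesic {a} {b} {m} between = on-geodesic-via between (between-start m b)

  on-geodesic⇒between : OnGeodesic G a b m m → Between a b m
  on-geodesic⇒between (_ , w , shortest-w , m∈w , _) with split-at w m∈w
  ... | i , j , w₁ , w₂ , i+j≡k = between-≤ (begin
    d _ _ + d _ _ ≤⟨ +-mono-≤ (d-minimal w₁) (d-minimal w₂) ⟩
    i + j         ≡⟨ i+j≡k ⟩
    _             ≡⟨ dist-unique shortest-w ⟩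
    d _ _         ∎)
    where open ≤-Reasoning

  module PseudoMedians (a b c : V G) where

    Median : V G → Set
    Median m = Between a b m × Between b c m × Between a c m

    median? : Dec (∃ Median)
    median? = any? (λ m → (_ ≟ _) ×-dec ((_ ≟ _) ×-dec (_ ≟ _)))

    median⇒pseudo-median : Median m → PseudoMedian G a b c m m m 0
    median⇒pseudo-median (ab , bc , ac) =
      ( between⇒on-geodesic ab , between⇒on-geodesic bc , between⇒on-geodesic ac
      , dist-zero , dist-zero , dist-zero) , λ _ _ _ _ _ → z≤n
      where dist-zero = [ tt ] , λ _ _ → z≤n

    size-zero-candidate⇒median : PMCandidate G a b c x y z 0 → Median x
    size-zero-candidate⇒median (ab , bc , ac , (wxy , _) , (wyz , _) , _)
      with empty-walk wxy | empty-walk wyz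
    ... | refl | refl = on-geodesic⇒between ab , on-geodesic⇒between bc , on-geodesic⇒between ac

    -- Without a median no candidate has size 0, so size 1 is minimal.
    size-one-pseudo-median : ¬ ∃ Median → PMCandidate G a b c x y z 1 → PseudoMedian G a b c x y z 1
    size-one-pseudo-median no-median candidate = candidate , minimal
      where
      minimal : ∀ x′ y′ z′ k′ → PMCandidate G a b c x′ y′ z′ k′ → 1 ≤ k′
      minimal x′ _ _ zero candidate₀ = ⊥-elim (no-median (x′ , size-zero-candidate⇒median candidate₀))
      minimal _ _ _ (suc _) _ = s≤s z≤n

  -- Two adjacent vertices at equal distance from r have a common neighbour
  -- one step closer to r: r itself at level 1, the rooted triangle
  -- condition at level ≥ 2.
  common-lower-neighbour : ∀ r → RootedTriangle G r → Adj x y → d r x ≡ d r y →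
    ∃[ z ] (d x z ≡ 1 × d y z ≡ 1 × Between x r z × Between y r z)
  common-lower-neighbour {x} {y} r rooted e same-level = at-level (d r x) refl same-level
    where
    at-level : ∀ p → d r x ≡ p → p ≡ d r y → ∃[ z ] (d x z ≡ 1 × d y z ≡ 1 × Between x r z × Between y r z)
    at-level zero rx≡0 0≡ry =
      ⊥-elim (irrefl (subst (Adj x) (trans (sym (d≡0⇒≡ (sym 0≡ry))) (d≡0⇒≡ rx≡0)) e))
    at-level 1 rx≡1 1≡ry =
      r , trans (d-sym x r) rx≡1 , trans (d-sym y r) (sym 1≡ry) , between-end x r , between-end y r
    at-level (suc (suc p)) rx≡2+p 2+p≡ry
      with rooted x y _ e (dist-of rx≡2+p) (dist-of (sym 2+p≡ry)) (s≤s (s≤s z≤n))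
    ... | z , zx , zy , dzr =
      z , trans (d-sym x z) (adjacent⇒d≡1 zx) , trans (d-sym y z) (adjacent⇒d≡1 zy) ,
      level-drop x zx rx≡2+p , level-drop y zy (sym 2+p≡ry)
      where
      -- z is a neighbour of w at distance p+1 from r, where d(w,r) = p+2.
      level-drop : ∀ w → Adj z w → d r w ≡ suc (suc p) → Between w r z
      level-drop w zw rw = begin
        d w z + d z r ≡⟨ cong₂ _+_ (trans (d-sym w z) (adjacent⇒d≡1 zw)) (sym (dist-unique dzr)) ⟩
        suc (suc p)   ≡⟨ sym rw ⟩
        d r w         ≡⟨ d-sym r w ⟩
        d w r         ∎
        where open ≡-Reasoning

  -- The edge x–y lies on a shortest a,b-path, traversed from x to y.
  EdgeOnGeodesic : V G → V G → V G → V G → Set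
  EdgeOnGeodesic a b x y = d a x + suc (d y b) ≤ d a b

  edge-reverse : EdgeOnGeodesic a b x y → EdgeOnGeodesic b a y x
  edge-reverse {a} {b} {x} {y} edge = begin
    d b y + suc (d x a) ≡⟨ cong₂ (λ s t → s + suc t) (d-sym b y) (d-sym x a) ⟩
    d y b + suc (d a x) ≡⟨ +-suc (d y b) (d a x) ⟩
    suc (d y b + d a x) ≡⟨ cong suc (+-comm (d y b) (d a x)) ⟩
    suc (d a x + d y b) ≡⟨ +-suc (d a x) (d y b) ⟨
    d a x + suc (d y b) ≤⟨ edge ⟩
    d a b               ≡⟨ d-sym a b ⟩
    d b a               ∎
    where open ≤-Reasoning

  step-bound : Adj x y → ∀ b → d x b ≤ suc (d y b)
  step-bound {x} {y} e b = ≤-trans (d-triangle x y b) (≤-reflexive (cong (_+ d y b) (adjacent⇒d≡1 e)))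

  edge-start-between : Adj x y → EdgeOnGeodesic a b x y → Between a b x
  edge-start-between {x} {y} {a} {b} e edge =
    between-≤ (≤-trans (+-monoʳ-≤ (d a x) (step-bound e b)) edge)

  lower-end-between : ∀ r → Adj x y → Between r b y → d r x < d r y → Between r b x
  lower-end-between {x} {y} {b} r e rby closer = between-≤ (begin
    d r x + d x b       ≤⟨ +-monoʳ-≤ (d r x) (step-bound e b) ⟩
    d r x + suc (d y b) ≡⟨ +-suc (d r x) (d y b) ⟩
    suc (d r x) + d y b ≤⟨ +-monoˡ-≤ (d y b) closer ⟩
    d r y + d y b       ≡⟨ rby ⟩
    d r b               ∎)
    where open ≤-Reasoning

  module Daisy (r : V G) (rooted : RootedTriangle G r) (u v : V G)
               (isometric : IsometricDaisy G r u v) where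
    open PseudoMedians u v r

    -- An isometric daisy contains a shortest u,v-path, which starts in I(r,u).
    daisy-crossing : Interval G r u v ⊎ Crossing (Interval G r u) (Interval G r v) u v (d u v)
    daisy-crossing = crossing daisy-geodesic (between⇒interval (between-end r u))
      where
      daisy-geodesic : WalkIn G (InDaisy G r u v) u v (d u v)
      daisy-geodesic = proj₁ (isometric u v (inj₁ (between⇒interval (between-end r u)))
        (inj₂ (between⇒interval (between-end r v))) (d u v) (dist-d u v))

    -- A crossing edge yields a median, or a size-1 candidate via a common
    -- lower neighbour of its ends.
    crossing-edge : Adj x y → EdgeOnGeodesic u v x y → Between r u x → Between r v y →
                    ∃ Median ⊎ ∃[ x ] ∃[ y ] ∃[ z ] PMCandidate G u v r x y z 1
    crossing-edge {x} {y} e edge rux rvy with <-cmp (d r x) (d r y)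
    ... | tri< closer _ _ = inj₁ (x , edge-start-between e edge ,
          between-sym (lower-end-between r e rvy closer) , between-sym rux)
    ... | tri> _ _ farther = inj₁ (y ,
          between-sym (edge-start-between (adj-sym e) (edge-reverse edge)) ,
          between-sym rvy , between-sym (lower-end-between r (adj-sym e) rux farther))
    ... | tri≈ _ same-level _ with common-lower-neighbour r rooted e same-level
    ...   | z , xz , yz , xrz , yrz = inj₂ (x , y , z ,
          on-geodesic (≤-trans (≤-reflexive (cong (λ t → d u x + (t + d y v)) (adjacent⇒d≡1 e))) edge) ,
          on-geodesic-via (between-sym rvy) yrz , on-geodesic-via (between-sym rux) xrz ,
          dist-of (adjacent⇒d≡1 e) , dist-of yz , dist-of xz)

    median-or-candidate : ∃ Median ⊎ ∃[ x ] ∃[ y ] ∃[ z ] PMCandidate G u v r x y z 1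
    median-or-candidate with daisy-crossing
    ... | inj₁ v∈Iru = inj₁ (v , between-end u v , between-start v r , between-sym (interval⇒between v∈Iru))
    ... | inj₂ (x , y , e , x∈Iru , y∈Irv , _ , _ , wux , wyv , len) =
      crossing-edge e (≤-trans (+-mono-≤ (d-minimal wux) (s≤s (d-minimal wyv))) (≤-reflexive len))
        (interval⇒between x∈Iru) (interval⇒between y∈Irv)

corollary2p7 : (G : Graph) → Connected G → (r : V G) → RootedTriangle G r →
    (u v : V G) → IsometricDaisy G r u v →
    ∃[ x ] ∃[ y ] ∃[ z ] ∃[ k ] (PseudoMedian G u v r x y z k × (k ≡ 0 ⊎ k ≡ 1))
corollary2p7 G connected r rooted u v isometric = conclude median? median-or-candidate
  where
  open Metric G connected
  open PseudoMedians u v r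
  open Daisy r rooted u v isometric

  conclude : Dec (∃ Median) → ∃ Median ⊎ ∃[ x ] ∃[ y ] ∃[ z ] PMCandidate G u v r x y z 1 →
             ∃[ x ] ∃[ y ] ∃[ z ] ∃[ k ] (PseudoMedian G u v r x y z k × (k ≡ 0 ⊎ k ≡ 1))
  conclude (yes (m , median)) _ = m , m , m , 0 , median⇒pseudo-median median , inj₁ refl
  conclude (no no-median) (inj₁ median) = ⊥-elim (no-median median)
  conclude (no no-median) (inj₂ (x , y , z , candidate)) =
    x , y , z , 1 , size-one-pseudo-median no-median candidate , inj₂ refl
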